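{- Let $H=(V,E)$ be a hypergraph of degree $2$ with $V=\{v_1,\dots,v_n\}$, $E=\{e_1,\dots,e_m\}$, and maps $i_1,i_2\colon V\to E$ with $i_1(v)\ne i_2(v)$, $v\in i_1(v)\cap i_2(v)$. Then for any $\vec{\alpha}\in\{0,1\}^{n}$ and $\vec{\beta}\in\{0,1\}^{m}$: $\mathcal{T}_H,\mathcal{A}_{\vec{\alpha},\vec{\beta}}\models{\boldsymbol q}_H$ iff $f_H(\vec{\alpha},\vec{\beta})=1$.
   Context: A hypergraph is of degree $2$ if every vertex lies in exactly two hyperedges. For each $e\in E$ take a variable $z_e$ and a unary predicate $A_e$; for each $v\in V$ a binary predicate $R_v$. ${\boldsymbol q}_H=\exists\vec{z}\bigwedge_{v\in V}R_v(z_{i_1(v)},z_{i_2(v)})$ is a Boolean CQ and $\mathcal{T}_H$ is the ontology with, for each $e\in E$, the tgd $\forall x\,\big(A_e(x)\to\exists y\,\big[\bigwedge_{v:\,i_1(v)=e}R_v(y,x)\land\bigwedge_{v:\,i_2(v)=e}R_v(x,y)\big]\big)$. For a constant $a$, $\mathcal{A}_{\vec{\alpha},\vec{\beta}}=\{R_{v_i}(a,a)\mid\vec{\alpha}(v_i)=1\}\cup\{A_{e_j}(a)\mid\vec{\beta}(e_j)=1\}$, where $\vec\alpha(v_i)$ is the $i$th component of $\vec\alpha$ and $\vec\beta(e_j)$ the $j$th component of $\vec\beta$. $\mathcal{T}_H,\mathcal{A}\models{\boldsymbol q}_H$ means ${\boldsymbol q}_H$ holds in every model of $\mathcal{T}_H\cup\mathcal{A}$.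 The hypergraph function is $f_H=\bigvee_{X\subseteq E\text{ independent}}\big(\bigwedge_{v\in V\setminus V_X}p_v\land\bigwedge_{e\in X}p_e\big)$, where $X$ is independent if its members are pairwise disjoint and $V_X$ is the set of vertices of hyperedges in $X$; $f_H(\vec\alpha,\vec\beta)$ evaluates it with $p_v:=\vec\alpha(v)$ and $p_e:=\vec\beta(e)$. -}

module Defs where

open import Data.Nat using (ℕ)
open import Data.Fin using (Fin)
open import Data.Fin.Subset using (Subset; _∈_; _∉_)
open import Data.Bool using (Bool; true)
open import Data.Vec using (Vec; lookup)
open import Data.Product using (Σ; _×_; ∃-syntax)
open import Data.Empty using (⊥)
open import Data.Sum using (_⊎_)
open import Relation.Nullary using (¬_)
open import Relation.Binary.PropositionalEquality using (_≡_; _≢_)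
open import Function.Bundles using (_⇔_)

-- The hyperedge e is the vertex set { v | i₁ v ≡ e or i₂ v ≡ e }, so every
-- vertex lies in exactly the two hyperedges i₁ v and i₂ v.
record Hypergraph2 : Set where
  field
    n m   : ℕ
    i₁ i₂ : Fin n → Fin m
    i≢    : ∀ v → i₁ v ≢ i₂ v

module _ (H : Hypergraph2) where
  open Hypergraph2 H

  _∈ₑ_ : Fin n → Fin m → Set
  v ∈ₑ e = (i₁ v ≡ e) ⊎ (i₂ v ≡ e)

  Independent : Subset m → Set
  Independent X = ∀ e e′ → e ∈ X → e′ ∈ X → e ≢ e′ → ∀ v → ¬ (v ∈ₑ e × v ∈ₑ e′)

  InVX : Subset m → Fin n → Set
  InVX X v = ∃[ e ] (e ∈ X × v ∈ₑ e)

  fH : Vec Bool n → Vec Bool m → Set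
  fH α β = ∃[ X ] (Independent X
                  × (∀ v → ¬ InVX X v → lookup α v ≡ true)
                  × (∀ e → e ∈ X → lookup β e ≡ true))

  record Interp : Set₁ where
    constructor interp
    field
      D  : Set
      a  : D
      A  : Fin m → D → Set
      R  : Fin n → D → D → Set

  module _ (I : Interp) where
    open Interp I

    ModelT : Set
    ModelT = ∀ e (x : D) → A e x →
               Σ D λ y → ((∀ v → i₁ v ≡ e → R v y x) × (∀ v → i₂ v ≡ e → R v x y))

    ModelA : Vec Bool n → Vec Bool m → Set
    ModelA α β = (∀ v → lookup α v ≡ true → R v a a)
               × (∀ e → lookup β e ≡ true → A e a)

    SatQ : Set
    SatQ = Σ (Fin m → D) λ z → (∀ v → R v (z (i₁ v)) (z (i₂ v)))

  Entails : Vec Bool n → Vec Bool m → Set₁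
  Entails α β = ∀ (I : Interp) → ModelT I → ModelA I α β → SatQ I

module Submission where

open import Defs
open import Data.Bool using (Bool; true)
open import Data.Bool.Properties using (T-≡) renaming (_≟_ to _≟ᵇ_)
open import Data.Empty using (⊥; ⊥-elim)
open import Data.Nat using (ℕ)
open import Data.Fin using (Fin)
open import Data.Fin.Properties using (_≟_)
open import Data.Fin.Subset using (Subset; _∈_)
open import Data.Fin.Subset.Properties using (_∈?_)
open import Data.Maybe using (Maybe; just; nothing)
open import Data.Maybe.Properties using (≡-dec)
open import Data.Product using (Σ; _×_; _,_; proj₁; proj₂)
open import Data.Sum using (inj₁; inj₂)
open import Data.Vec using (Vec; lookup; tabulate)
open import Data.Vec.Properties using (lookup∘tabulate; []=⇒lookup; lookup⇒[]=)
open import Function using (_∘_)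
open import Function.Bundles using (_⇔_; mk⇔; Equivalence)
open import Level using (Level)
open import Relation.Nullary using (¬_; yes; no; does)
open import Relation.Nullary.Decidable using (dec-true; toWitness; isYes; isYes≗does; _×-dec_)
open import Relation.Unary using (Pred; Decidable)
open import Relation.Binary.PropositionalEquality using (_≡_; refl; trans; subst₂; module ≡-Reasoning)

-- If f_H(α, β) holds via X, a match of q_H sends each e ∈ X to the R-successor
-- that T_H creates for A_e(a) and every other edge to a; independence of X means
-- no vertex atom joins two such successors, and vertices outside V_X become
-- loops R_v(a, a) ∈ A_{α,β}. Conversely, in the canonical model over
-- {a} ∪ {anonymous successor of a for each A_e(a)}, the edges that a match sends
-- to their own successor form an independent set witnessing f_H(α, β).

module _ {ℓ : Level} {k : ℕ} {P : Pred (Fin k) ℓ} (P? : Decidable P) where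

  select : Subset k
  select = tabulate (does ∘ P?)

  ∈-select⁺ : ∀ {i} → P i → i ∈ select
  ∈-select⁺ {i} p = lookup⇒[]= i select (trans (lookup∘tabulate (does ∘ P?) i) (dec-true (P? i) p))

  ∈-select⁻ : ∀ {i} → i ∈ select → P i
  ∈-select⁻ {i} i∈ =
    toWitness {a? = P? i} (Equivalence.from T-≡ (begin
      isYes (P? i)           ≡⟨ isYes≗does (P? i) ⟩
      does (P? i)            ≡⟨ lookup∘tabulate (does ∘ P?) i ⟨
      lookup select i        ≡⟨ []=⇒lookup i∈ ⟩
      true                   ∎))
    where open ≡-Reasoning

module _ (H : Hypergraph2) (α : Vec Bool (Hypergraph2.n H)) (β : Vec Bool (Hypergraph2.m H)) where
  open Hypergraph2 H

  fH⇒Entails : fH H α β → Entails H α β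
  fH⇒Entails (X , independent , outsideVX , X⊆β) (interp D a A R) modelT (loops , A-facts) = z , match
    where
      successor : ∀ {e} → e ∈ X →
                  Σ D λ y → ((∀ v → i₁ v ≡ e → R v y a) × (∀ v → i₂ v ≡ e → R v a y))
      successor {e} e∈X = modelT e a (A-facts e (X⊆β e e∈X))

      z : Fin m → D
      z e with e ∈? X
      ... | yes e∈X = proj₁ (successor e∈X)
      ... | no _    = a

      match : ∀ v → R v (z (i₁ v)) (z (i₂ v))
      match v with i₁ v ∈? X | i₂ v ∈? X
      ... | yes p | yes q = ⊥-elim (independent _ _ p q (i≢ v) v (inj₁ refl , inj₂ refl))
      ... | yes p | no _  = proj₁ (proj₂ (successor p)) v refl
      ... | no _  | yes q = proj₂ (proj₂ (successor q)) v refl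
      ... | no p  | no q  = loops v (outsideVX v λ where
                              (_ , e∈X , inj₁ refl) → p e∈X
                              (_ , e∈X , inj₂ refl) → q e∈X)

  -- nothing is the constant a, just e the anonymous R-successor of a required by A_e(a).
  canonical : Interp H
  canonical = interp (Maybe (Fin m)) nothing A R
    where
      A : Fin m → Maybe (Fin m) → Set
      A e x = (x ≡ nothing) × (lookup β e ≡ true)

      R : Fin n → Maybe (Fin m) → Maybe (Fin m) → Set
      R v nothing  nothing  = lookup α v ≡ true
      R v (just e) nothing  = (i₁ v ≡ e) × (lookup β e ≡ true)
      R v nothing  (just e) = (i₂ v ≡ e) × (lookup β e ≡ true)
      R v (just _) (just _) = ⊥

  canonical-ModelT : ModelT H canonical
  canonical-ModelT e .nothing (refl , βe) = just e , (λ _ i₁v≡e → i₁v≡e , βe) , (λ _ i₂v≡e → i₂v≡e , βe)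

  canonical-ModelA : ModelA H canonical α β
  canonical-ModelA = (λ _ αv → αv) , (λ _ βe → refl , βe)

  canonicalMatch⇒fH : SatQ H canonical → fH H α β
  canonicalMatch⇒fH (z , match) = X , independent , outsideVX , X⊆β
    where
      -- The β-condition matters for edges containing no vertex: z may send them anywhere.
      SentToSuccessor : Fin m → Set
      SentToSuccessor e = (z e ≡ just e) × (lookup β e ≡ true)

      sentToSuccessor? : Decidable SentToSuccessor
      sentToSuccessor? e = ≡-dec _≟_ (z e) (just e) ×-dec (lookup β e ≟ᵇ true)

      X : Subset m
      X = select sentToSuccessor?

      ∈X⁺ : ∀ {e} → SentToSuccessor e → e ∈ X
      ∈X⁺ = ∈-select⁺ sentToSuccessor?

      ∈X⁻ : ∀ {e} → e ∈ X → SentToSuccessor e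
      ∈X⁻ = ∈-select⁻ sentToSuccessor?

      X⊆β : ∀ e → e ∈ X → lookup β e ≡ true
      X⊆β _ = proj₂ ∘ ∈X⁻

      bothEndsInX : ∀ v → i₁ v ∈ X → i₂ v ∈ X → ⊥
      bothEndsInX v p q = subst₂ (Interp.R canonical v) (proj₁ (∈X⁻ p)) (proj₁ (∈X⁻ q)) (match v)

      independent : Independent H X
      independent _ _ _  _  e≢e′ _ (inj₁ refl , inj₁ refl) = e≢e′ refl
      independent _ _ _  _  e≢e′ _ (inj₂ refl , inj₂ refl) = e≢e′ refl
      independent _ _ p  q  _    v (inj₁ refl , inj₂ refl) = bothEndsInX v p q
      independent _ _ p  q  _    v (inj₂ refl , inj₁ refl) = bothEndsInX v q p

      outsideVX : ∀ v → ¬ InVX H X v → lookup α v ≡ true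
      outsideVX v v∉VX with z (i₁ v) in z₁ | z (i₂ v) in z₂ | match v
      ... | nothing | nothing | αv         = αv
      ... | just _  | nothing | (refl , βe) = ⊥-elim (v∉VX (i₁ v , ∈X⁺ (z₁ , βe) , inj₁ refl))
      ... | nothing | just _  | (refl , βe) = ⊥-elim (v∉VX (i₂ v , ∈X⁺ (z₂ , βe) , inj₂ refl))
      ... | just _  | just _  | ()

  Entails⇒fH : Entails H α β → fH H α β
  Entails⇒fH entails = canonicalMatch⇒fH (entails canonical canonical-ModelT canonical-ModelA)

theorem11 : (H : Hypergraph2) (α : Vec Bool (Hypergraph2.n H)) (β : Vec Bool (Hypergraph2.m H)) →
    Entails H α β ⇔ fH H α β
theorem11 H α β = mk⇔ (Entails⇒fH H α β) (fH⇒Entails H α β)
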